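{- Let $T$ be a (finite) tree. Then $Mo(T)$ is an even number.
   Context: For a connected graph $G$ and an edge $uv\in E(G)$, let $n_u$ be the number of vertices of $G$ strictly closer (in shortest-path distance) to $u$ than to $v$, and $n_v$ analogously. The Mostar index of $G$ is $Mo(G)=\sum_{uv\in E(G)}|n_u-n_v|$. -}

module Defs where

open import Data.Nat using (ℕ; zero; suc; _≤_; _<ᵇ_; ∣_-_∣)
open import Data.Bool using (Bool; true; false; if_then_else_; _∧_)
open import Data.Fin using (Fin; toℕ)
open import Data.List using (List; []; _∷_; _++_; [_]; length; map; allFin)
open import Data.Nat.ListAction using (sum)
open import Data.List.Relation.Unary.Unique.Propositional using (Unique)
open import Data.List.Relation.Unary.Linked using (Linked)
open import Data.Product using (Σ; ∃; _×_)
open import Relation.Binary.PropositionalEquality using (_≡_)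
open import Relation.Nullary using (¬_)

record SimpleGraph (n : ℕ) : Set where
  field
    adj    : Fin n → Fin n → Bool
    sym    : ∀ u v → adj u v ≡ adj v u
    irrefl : ∀ u → adj u u ≡ false

module _ {n : ℕ} (G : SimpleGraph n) where
  open SimpleGraph G

  Adj : Fin n → Fin n → Set
  Adj u v = adj u v ≡ true

  data Walk : Fin n → Fin n → ℕ → Set where
    nil  : ∀ {u} → Walk u u 0
    cons : ∀ {u v w k} → Adj u v → Walk v w k → Walk u w (suc k)

  Connected : Set
  Connected = ∀ u v → ∃ λ k → Walk u v k

  -- A cycle: at least 3 distinct vertices x ∷ mid ++ [ y ], consecutive ones
  -- adjacent, and y adjacent to x.
  record Cycle : Set where
    field
      first  : Fin n
      middle : List (Fin n)
      final  : Fin n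
      long   : 1 ≤ length middle
      distinct : Unique (first ∷ middle ++ [ final ])
      chain  : Linked Adj (first ∷ middle ++ [ final ])
      closes : Adj final first

  Acyclic : Set
  Acyclic = ¬ Cycle

  IsTree : Set
  IsTree = Connected × Acyclic

  IsDistance : (Fin n → Fin n → ℕ) → Set
  IsDistance d = ∀ u v → Walk u v (d u v) × (∀ k → Walk u v k → d u v ≤ k)

  module _ (d : Fin n → Fin n → ℕ) where
    closerCount : Fin n → Fin n → ℕ
    closerCount u v = sum (map (λ w → if d w u <ᵇ d w v then 1 else 0) (allFin n))

    -- Mostar index: sum over edges {u,v} (each counted once, via toℕ u < toℕ v).
    mostar : ℕ
    mostar = sum (map (λ u → sum (map (λ v →
               if adj u v ∧ (toℕ u <ᵇ toℕ v)
               then ∣ closerCount u v - closerCount v u ∣ else 0) (allFin n))) (allFin n))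

{-# OPTIONS --safe #-}
-- Since ∣ x - y ∣ ≡ x + y (mod 2), Mo(T) has the parity of the sum of n_u + n_v over the edges uv.
-- That sum counts the pairs (w, oriented edge u → v) with w strictly closer to u than to v;
-- grouping by w, it counts the edges pointing towards w. Rooted at w, every other vertex has
-- exactly one neighbour one level closer to w (two would close a cycle), so each w contributes
-- n - 1 and the total n (n - 1) is even.
module Submission where

open import Defs
open import Data.Bool using (Bool; true; false; if_then_else_; _∧_; T)
open import Data.Bool.Properties using (∧-zeroʳ)
open import Data.Empty using (⊥; ⊥-elim)
open import Data.Fin using (Fin; toℕ; punchIn)
open import Data.Fin.Properties using (toℕ-injective; punchInᵢ≢i) renaming (_≟_ to _≟ᶠ_)
open import Data.List using (List; []; _∷_; _++_; [_]; map; allFin; tabulate)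
open import Data.List.Properties using (map-tabulate)
open import Data.List.Relation.Unary.All using (All; []; _∷_) renaming (map to all-map)
open import Data.List.Relation.Unary.All.Properties using (∷ʳ⁺; ∷ʳ⁻)
open import Data.List.Relation.Unary.AllPairs using ([]; _∷_)
open import Data.List.Relation.Unary.Linked using (Linked; [-]; _∷_)
open import Data.List.Relation.Unary.Unique.Propositional using (Unique)
open import Data.Nat using (ℕ; zero; suc; _+_; _*_; _∸_; _≤_; _<_; _<ᵇ_; ∣_-_∣; _⊓_; z≤n; s≤s)
open import Data.Nat.Properties
open import Data.Nat.Divisibility using (_∣_; divides; ∣m+n∣m⇒∣n; ∣m∣n⇒∣m+n; m∣m*n)
import Data.Nat.ListAction as List
open import Data.Nat.Tactic.RingSolver using (solve-∀)
open import Data.Product using (∃; _×_; _,_; proj₁; proj₂)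
open import Data.Unit using (tt)
open import Data.Vec.Functional using (head; tail)
open import Function using (id; _∘_)
open import Relation.Binary.PropositionalEquality
  using (_≡_; _≢_; refl; sym; trans; cong; cong₂; subst; ≢-sym; module ≡-Reasoning)
open import Relation.Nullary using (¬_; yes; no; contradiction)

open import Algebra.Properties.CommutativeMonoid.Sum +-0-commutativeMonoid
  using (sum; sum-syntax; sum-cong-≗; sum-remove; sum-replicate-zero; ∑-distrib-+; ∑-comm)
open import Algebra.Properties.Semiring.Sum +-*-semiring using (*-distribˡ-sum)

when : Bool → ℕ → ℕ
when b x = if b then x else 0

when-+ : ∀ b x y → when b (x + y) ≡ when b x + when b y
when-+ true  x y = refl
when-+ false x y = refl

𝟙 : Bool → ℕ
𝟙 b = when b 1

<ᵇ≡true⇒< : ∀ m n → (m <ᵇ n) ≡ true → m < n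
<ᵇ≡true⇒< m n m<ᵇn = <ᵇ⇒< m n (subst T (sym m<ᵇn) tt)

<ᵇ≡false⇒≮ : ∀ m n → (m <ᵇ n) ≡ false → ¬ m < n
<ᵇ≡false⇒≮ _ _ m≮ᵇn m<n = subst T m≮ᵇn (<⇒<ᵇ m<n)

<⇒<ᵇ≡true : ∀ {m n} → m < n → (m <ᵇ n) ≡ true
<⇒<ᵇ≡true {m} {n} m<n with m <ᵇ n in m<ᵇn
... | true  = refl
... | false = contradiction m<n (<ᵇ≡false⇒≮ m n m<ᵇn)

∣m-n∣+2*[m⊓n]≡m+n : ∀ m n → ∣ m - n ∣ + 2 * (m ⊓ n) ≡ m + n
∣m-n∣+2*[m⊓n]≡m+n zero    n       = +-identityʳ n
∣m-n∣+2*[m⊓n]≡m+n (suc m) zero    = refl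
∣m-n∣+2*[m⊓n]≡m+n (suc m) (suc n) = begin
  ∣ m - n ∣ + 2 * suc (m ⊓ n)     ≡⟨ shift ∣ m - n ∣ (m ⊓ n) ⟩
  2 + (∣ m - n ∣ + 2 * (m ⊓ n))   ≡⟨ cong (2 +_) (∣m-n∣+2*[m⊓n]≡m+n m n) ⟩
  2 + (m + n)                     ≡⟨ cong suc (+-suc m n) ⟨
  suc m + suc n                   ∎
  where
  open ≡-Reasoning
  shift : ∀ x y → x + 2 * suc y ≡ 2 + (x + 2 * y)
  shift = solve-∀

2∣n*[n∸1] : ∀ n → 2 ∣ n * (n ∸ 1)
2∣n*[n∸1] zero          = divides 0 refl
2∣n*[n∸1] (suc zero)    = divides 0 refl
2∣n*[n∸1] (suc (suc m)) =
  subst (2 ∣_) (sym (step m)) (∣m∣n⇒∣m+n (2∣n*[n∸1] (suc m)) (m∣m*n (suc m)))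
  where
  step : ∀ m → suc (suc m) * suc m ≡ suc m * m + 2 * suc m
  step = solve-∀

∑-const : ∀ n c → ∑[ i < n ] c ≡ n * c
∑-const zero    c = refl
∑-const (suc n) c = cong (c +_) (∑-const n c)

∑-punctured : ∀ {n c} (t : Fin n → ℕ) i → (∀ j → j ≢ i → t j ≡ c) → sum t ≡ t i + (n ∸ 1) * c
∑-punctured {suc n} {c} t i others = begin
  sum t                      ≡⟨ sum-remove {i = i} t ⟩
  t i + sum (t ∘ punchIn i)  ≡⟨ cong (t i +_) (sum-cong-≗ (λ j → others _ (punchInᵢ≢i i j))) ⟩
  t i + ∑[ j < n ] c         ≡⟨ cong (t i +_) (∑-const n c) ⟩
  t i + n * c                ∎
  where open ≡-Reasoning

∑-linear : ∀ {n} k {f g h : Fin n → ℕ} → (∀ i → f i + k * g i ≡ h i) → sum f + k * sum g ≡ sum h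
∑-linear k {f} {g} {h} pointwise = begin
  sum f + k * sum g            ≡⟨ cong (sum f +_) (*-distribˡ-sum k g) ⟩
  sum f + sum (λ i → k * g i)  ≡⟨ ∑-distrib-+ f _ ⟨
  sum (λ i → f i + k * g i)    ≡⟨ sum-cong-≗ pointwise ⟩
  sum h                        ∎
  where open ≡-Reasoning

∑²-cong : ∀ {m n} {f g : Fin m → Fin n → ℕ} → (∀ i j → f i j ≡ g i j) →
  ∑[ i < m ] ∑[ j < n ] f i j ≡ ∑[ i < m ] ∑[ j < n ] g i j
∑²-cong f≗g = sum-cong-≗ (λ i → sum-cong-≗ (f≗g i))

∑²-distrib-+ : ∀ {m n} (f g : Fin m → Fin n → ℕ) →
  ∑[ i < m ] ∑[ j < n ] (f i j + g i j) ≡ ∑[ i < m ] ∑[ j < n ] f i j + ∑[ i < m ] ∑[ j < n ] g i j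
∑²-distrib-+ f g = trans (sum-cong-≗ (λ i → ∑-distrib-+ (f i) (g i))) (∑-distrib-+ (λ i → sum (f i)) (λ i → sum (g i)))

sum-tabulate : ∀ {n} (f : Fin n → ℕ) → List.sum (tabulate f) ≡ sum f
sum-tabulate {zero}  f = refl
sum-tabulate {suc n} f = cong (head f +_) (sum-tabulate (tail f))

sum-allFin : ∀ {n} (f : Fin n → ℕ) → List.sum (map f (allFin n)) ≡ sum f
sum-allFin f = trans (cong List.sum (map-tabulate id f)) (sum-tabulate f)

Unique-∷ʳ : ∀ {A : Set} {xs : List A} {y} → Unique xs → All (_≢ y) xs → Unique (xs ++ [ y ])
Unique-∷ʳ []            []           = [] ∷ []
Unique-∷ʳ (x∉xs ∷ uniq) (x≢y ∷ xs≢y) = ∷ʳ⁺ x∉xs x≢y ∷ Unique-∷ʳ uniq xs≢y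

Linked-∷ʳ : ∀ {A : Set} {R : A → A → Set} {x y z} (xs : List A) →
  Linked R (x ∷ xs ++ [ y ]) → R y z → Linked R (x ∷ (xs ++ [ y ]) ++ [ z ])
Linked-∷ʳ []       (Rxy ∷ [-]) Ryz = Rxy ∷ Ryz ∷ [-]
Linked-∷ʳ (_ ∷ xs) (Rxx ∷ lnk) Ryz = Rxx ∷ Linked-∷ʳ xs lnk Ryz

module Walks {n} (G : SimpleGraph n) where

  adj-sym : ∀ {u v} → Adj G u v → Adj G v u
  adj-sym {u} {v} uv = trans (SimpleGraph.sym G v u) uv

  walk-length-zero : ∀ {u v} → Walk G u v 0 → u ≡ v
  walk-length-zero nil = refl

  snoc : ∀ {u v x k} → Walk G u v k → Adj G v x → Walk G u x (suc k)
  snoc nil          vx = cons vx nil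
  snoc (cons uw wv) vx = cons uw (snoc wv vx)

  unsnoc : ∀ {u x k} → Walk G u x (suc k) → ∃ λ v → Walk G u v k × Adj G v x
  unsnoc (cons ux nil) = _ , nil , ux
  unsnoc (cons uw wx@(cons _ _)) with unsnoc wx
  ... | v , wv , vx = v , cons uw wv , vx

module Levels {n} (G : SimpleGraph n) {d : Fin n → Fin n → ℕ} (isD : IsDistance G d) (root : Fin n) where
  open SimpleGraph G using (adj)
  open Walks G

  level : Fin n → ℕ
  level = d root

  geodesic : ∀ x → Walk G root x (level x)
  geodesic x = proj₁ (isD root x)

  level-minimal : ∀ {x k} → Walk G root x k → level x ≤ k
  level-minimal = proj₂ (isD root _) _

  level-root : level root ≡ 0
  level-root = n≤0⇒n≡0 (level-minimal nil)

  level≡0⇒root : ∀ {x} → level x ≡ 0 → root ≡ x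
  level≡0⇒root {x} lx = walk-length-zero (subst (Walk G root x) lx (geodesic x))

  level-adj : ∀ {u v} → Adj G u v → level v ≤ suc (level u)
  level-adj {u} uv = level-minimal (snoc (geodesic u) uv)

  level-rise : ∀ {u v} → Adj G u v → level u < level v → level v ≡ suc (level u)
  level-rise uv lu<lv = ≤-antisym (level-adj uv) lu<lv

  parent : ∀ {x j} → level x ≡ suc j → ∃ λ p → Adj G p x × level p ≡ j
  parent {x} {j} lx with unsnoc (subst (Walk G root x) lx (geodesic x))
  ... | p , rp , px = p , px , ≤-antisym (level-minimal rp) (≤-pred (subst (_≤ suc (level p)) lx (level-adj px)))

  level-≢ : ∀ {p x j} → level p ≡ j → suc j ≤ level x → p ≢ x
  level-≢ lp lx refl = <-irrefl (sym lp) lx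

  root-has-no-parent : ∑[ u < n ] 𝟙 (adj u root ∧ (level u <ᵇ level root)) ≡ 0
  root-has-no-parent rewrite level-root =
    trans (sum-cong-≗ (λ u → cong 𝟙 (∧-zeroʳ (adj u root)))) (sum-replicate-zero n)

  module _ (acyclic : Acyclic G) where

    -- Climbing to parents from both ends, the two climbs meet strictly above the root: a cycle.
    no-path-above-level : ∀ i {a b} (xs : List (Fin n)) → level a ≡ i → level b ≡ i →
      Unique (b ∷ xs ++ [ a ]) → Linked (Adj G) (b ∷ xs ++ [ a ]) → All (λ x → i ≤ level x) (b ∷ xs ++ [ a ]) → ⊥
    no-path-above-level zero {a} {b} xs la lb (b∉ ∷ _) _ _ =
      proj₂ (∷ʳ⁻ {xs = xs} b∉) (trans (sym (level≡0⇒root lb)) (level≡0⇒root la))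
    no-path-above-level (suc j) {a} {b} xs la lb uniq lnk above with parent la | parent lb
    ... | a' , a'a , la' | b' , b'b , lb' with a' ≟ᶠ b'
    ... | yes refl = acyclic record
      { first = a' ; middle = b ∷ xs ; final = a ; long = s≤s z≤n
      ; distinct = all-map (level-≢ la') above ∷ uniq
      ; chain = b'b ∷ lnk
      ; closes = adj-sym a'a }
    ... | no a'≢b' = no-path-above-level j (b ∷ xs ++ [ a ]) la' lb'
      (∷ʳ⁺ (all-map (level-≢ lb') above) (≢-sym a'≢b') ∷ Unique-∷ʳ uniq (all-map (≢-sym ∘ level-≢ la') above))
      (b'b ∷ Linked-∷ʳ xs lnk (adj-sym a'a))
      (≤-reflexive (sym lb') ∷ ∷ʳ⁺ (all-map (≤-trans (n≤1+n j)) above) (≤-reflexive (sym la')))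

    parent-unique : ∀ {u₁ u₂ v} → Adj G u₁ v → Adj G u₂ v → level u₁ < level v → level u₂ < level v → u₁ ≡ u₂
    parent-unique {u₁} {u₂} {v} u₁v u₂v l₁ l₂ with u₁ ≟ᶠ u₂
    ... | yes u₁≡u₂ = u₁≡u₂
    ... | no u₁≢u₂ = ⊥-elim (no-path-above-level (level u₁) [ v ] refl same-level
      ((u₂≢v ∷ ≢-sym u₁≢u₂ ∷ []) ∷ (≢-sym u₁≢v ∷ []) ∷ [] ∷ [])
      (u₂v ∷ adj-sym u₁v ∷ [-])
      (≤-reflexive (sym same-level) ∷ <⇒≤ l₁ ∷ ≤-refl ∷ []))
      where
      same-level : level u₂ ≡ level u₁
      same-level = suc-injective (trans (sym (level-rise u₂v l₂)) (level-rise u₁v l₁))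
      u₁≢v : u₁ ≢ v
      u₁≢v = level-≢ refl l₁
      u₂≢v : u₂ ≢ v
      u₂≢v = level-≢ refl l₂

    nonroot-parent : ∀ {v} → v ≢ root → ∃ λ p → Adj G p v × level p < level v
    nonroot-parent {v} v≢root with level v in lv
    ... | zero  = contradiction (sym (level≡0⇒root lv)) v≢root
    ... | suc j with parent lv
    ... | p , pv , lp = p , pv , ≤-reflexive (cong suc lp)

    nonroot-has-one-parent : ∀ {v} → v ≢ root → ∑[ u < n ] 𝟙 (adj u v ∧ (level u <ᵇ level v)) ≡ 1
    nonroot-has-one-parent {v} v≢root with nonroot-parent v≢root
    ... | p , pv , p<v = begin
      ∑[ u < n ] 𝟙 (adj u v ∧ (level u <ᵇ level v))  ≡⟨ ∑-punctured _ p not-parent ⟩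
      𝟙 (adj p v ∧ (level p <ᵇ level v)) + (n ∸ 1) * 0 ≡⟨ cong₂ _+_ is-parent (*-zeroʳ (n ∸ 1)) ⟩
      1                                               ∎
      where
      open ≡-Reasoning
      is-parent : 𝟙 (adj p v ∧ (level p <ᵇ level v)) ≡ 1
      is-parent rewrite pv | <⇒<ᵇ≡true p<v = refl
      not-parent : ∀ u → u ≢ p → 𝟙 (adj u v ∧ (level u <ᵇ level v)) ≡ 0
      not-parent u u≢p with adj u v in uv | level u <ᵇ level v in u<v
      ... | false | _     = refl
      ... | true  | false = refl
      ... | true  | true  = contradiction (parent-unique uv pv (<ᵇ≡true⇒< (level u) (level v) u<v) p<v) u≢p

    downward-edges : ∑[ v < n ] ∑[ u < n ] 𝟙 (adj u v ∧ (level u <ᵇ level v)) ≡ n ∸ 1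
    downward-edges = begin
      ∑[ v < n ] ∑[ u < n ] 𝟙 (adj u v ∧ (level u <ᵇ level v))
        ≡⟨ ∑-punctured _ root (λ _ → nonroot-has-one-parent) ⟩
      ∑[ u < n ] 𝟙 (adj u root ∧ (level u <ᵇ level root)) + (n ∸ 1) * 1
        ≡⟨ cong₂ _+_ root-has-no-parent (*-identityʳ (n ∸ 1)) ⟩
      n ∸ 1
        ∎
      where open ≡-Reasoning

module Mostar {n} (G : SimpleGraph n) (d : Fin n → Fin n → ℕ) where
  open SimpleGraph G using (adj)

  edge : Fin n → Fin n → Bool
  edge u v = adj u v ∧ (toℕ u <ᵇ toℕ v)

  c : Fin n → Fin n → ℕ
  c = closerCount G d

  edge-orientations : ∀ u v x → when (edge u v) x + when (edge v u) x ≡ when (adj u v) x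
  edge-orientations u v x rewrite SimpleGraph.sym G v u
    with adj u v in uv | toℕ u <ᵇ toℕ v in u<v | toℕ v <ᵇ toℕ u in v<u
  ... | false | _     | _     = refl
  ... | true  | true  | true  = contradiction (<ᵇ≡true⇒< (toℕ v) (toℕ u) v<u) (<⇒≯ (<ᵇ≡true⇒< (toℕ u) (toℕ v) u<v))
  ... | true  | true  | false = +-identityʳ x
  ... | true  | false | true  = refl
  ... | true  | false | false with toℕ-injective toℕ-u≡v
    where
    toℕ-u≡v : toℕ u ≡ toℕ v
    toℕ-u≡v = ≤-antisym (≮⇒≥ (<ᵇ≡false⇒≮ (toℕ v) (toℕ u) v<u)) (≮⇒≥ (<ᵇ≡false⇒≮ (toℕ u) (toℕ v) u<v))
  ... | refl = contradiction (trans (sym uv) (SimpleGraph.irrefl G u)) λ ()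

  ∑-edges-both-ways : (f : Fin n → Fin n → ℕ) →
    ∑[ u < n ] ∑[ v < n ] when (edge u v) (f u v + f v u) ≡ ∑[ u < n ] ∑[ v < n ] when (adj u v) (f u v)
  ∑-edges-both-ways f = begin
    ∑[ u < n ] ∑[ v < n ] when (edge u v) (f u v + f v u)
      ≡⟨ ∑²-cong (λ u v → when-+ (edge u v) (f u v) (f v u)) ⟩
    ∑[ u < n ] ∑[ v < n ] (when (edge u v) (f u v) + when (edge u v) (f v u))
      ≡⟨ ∑²-distrib-+ (λ u v → when (edge u v) (f u v)) (λ u v → when (edge u v) (f v u)) ⟩
    ∑[ u < n ] ∑[ v < n ] when (edge u v) (f u v) + ∑[ u < n ] ∑[ v < n ] when (edge u v) (f v u)
      ≡⟨ cong (∑[ u < n ] ∑[ v < n ] when (edge u v) (f u v) +_) (∑-comm (λ u v → when (edge u v) (f v u))) ⟩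
    ∑[ u < n ] ∑[ v < n ] when (edge u v) (f u v) + ∑[ u < n ] ∑[ v < n ] when (edge v u) (f u v)
      ≡⟨ ∑²-distrib-+ (λ u v → when (edge u v) (f u v)) (λ u v → when (edge v u) (f u v)) ⟨
    ∑[ u < n ] ∑[ v < n ] (when (edge u v) (f u v) + when (edge v u) (f u v))
      ≡⟨ ∑²-cong (λ u v → edge-orientations u v (f u v)) ⟩
    ∑[ u < n ] ∑[ v < n ] when (adj u v) (f u v)
      ∎
    where open ≡-Reasoning

  mostar-∑ : mostar G d ≡ ∑[ u < n ] ∑[ v < n ] when (edge u v) ∣ c u v - c v u ∣
  mostar-∑ = trans (sum-allFin (λ u → List.sum (map (λ v → when (edge u v) ∣ c u v - c v u ∣) (allFin n))))
                   (sum-cong-≗ (λ u → sum-allFin (λ v → when (edge u v) ∣ c u v - c v u ∣)))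

  minSum : ℕ
  minSum = ∑[ u < n ] ∑[ v < n ] when (edge u v) (c u v ⊓ c v u)

  mostar+2*minSum : mostar G d + 2 * minSum ≡ ∑[ u < n ] ∑[ v < n ] when (edge u v) (c u v + c v u)
  mostar+2*minSum = begin
    mostar G d + 2 * minSum
      ≡⟨ cong (_+ 2 * minSum) mostar-∑ ⟩
    ∑[ u < n ] ∑[ v < n ] when (edge u v) ∣ c u v - c v u ∣ + 2 * minSum
      ≡⟨ ∑-linear 2 (λ u → ∑-linear 2 (λ v → pointwise (edge u v) (c u v) (c v u))) ⟩
    ∑[ u < n ] ∑[ v < n ] when (edge u v) (c u v + c v u)
      ∎
    where
    open ≡-Reasoning
    pointwise : ∀ b x y → when b ∣ x - y ∣ + 2 * when b (x ⊓ y) ≡ when b (x + y)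
    pointwise true  x y = ∣m-n∣+2*[m⊓n]≡m+n x y
    pointwise false x y = refl

  ∑-adjacent-closerCount :
    ∑[ u < n ] ∑[ v < n ] when (adj u v) (c u v) ≡ ∑[ w < n ] ∑[ v < n ] ∑[ u < n ] 𝟙 (adj u v ∧ (d w u <ᵇ d w v))
  ∑-adjacent-closerCount = begin
    ∑[ u < n ] ∑[ v < n ] when (adj u v) (c u v)
      ≡⟨ ∑²-cong pointwise ⟩
    ∑[ u < n ] ∑[ v < n ] ∑[ w < n ] 𝟙 (adj u v ∧ (d w u <ᵇ d w v))
      ≡⟨ sum-cong-≗ (λ u → ∑-comm (λ v w → 𝟙 (adj u v ∧ (d w u <ᵇ d w v)))) ⟩
    ∑[ u < n ] ∑[ w < n ] ∑[ v < n ] 𝟙 (adj u v ∧ (d w u <ᵇ d w v))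
      ≡⟨ ∑-comm (λ u w → ∑[ v < n ] 𝟙 (adj u v ∧ (d w u <ᵇ d w v))) ⟩
    ∑[ w < n ] ∑[ u < n ] ∑[ v < n ] 𝟙 (adj u v ∧ (d w u <ᵇ d w v))
      ≡⟨ sum-cong-≗ (λ w → ∑-comm (λ u v → 𝟙 (adj u v ∧ (d w u <ᵇ d w v)))) ⟩
    ∑[ w < n ] ∑[ v < n ] ∑[ u < n ] 𝟙 (adj u v ∧ (d w u <ᵇ d w v))
      ∎
    where
    open ≡-Reasoning
    pointwise : ∀ u v → when (adj u v) (c u v) ≡ ∑[ w < n ] 𝟙 (adj u v ∧ (d w u <ᵇ d w v))
    pointwise u v with adj u v
    ... | true  = sum-allFin (λ w → 𝟙 (d w u <ᵇ d w v))
    ... | false = sym (sum-replicate-zero n)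

mainTheorem2 : (n : ℕ) (T : SimpleGraph n) → IsTree T →
    (d : Fin n → Fin n → ℕ) → IsDistance T d → 2 ∣ mostar T d
mainTheorem2 n T (_ , acyclic) d isD = ∣m+n∣m⇒∣n (subst (2 ∣_) (sym counting) (2∣n*[n∸1] n)) (m∣m*n minSum)
  where
  open Mostar T d
  open SimpleGraph T using (adj)
  open ≡-Reasoning

  counting : 2 * minSum + mostar T d ≡ n * (n ∸ 1)
  counting = begin
    2 * minSum + mostar T d                                           ≡⟨ +-comm (2 * minSum) _ ⟩
    mostar T d + 2 * minSum                                           ≡⟨ mostar+2*minSum ⟩
    ∑[ u < n ] ∑[ v < n ] when (edge u v) (c u v + c v u)             ≡⟨ ∑-edges-both-ways c ⟩
    ∑[ u < n ] ∑[ v < n ] when (adj u v) (c u v)                      ≡⟨ ∑-adjacent-closerCount ⟩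
    ∑[ w < n ] ∑[ v < n ] ∑[ u < n ] 𝟙 (adj u v ∧ (d w u <ᵇ d w v))  ≡⟨ sum-cong-≗ (λ w → Levels.downward-edges T isD w acyclic) ⟩
    ∑[ w < n ] (n ∸ 1)                                                ≡⟨ ∑-const n (n ∸ 1) ⟩
    n * (n ∸ 1)                                                       ∎
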